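{- Let the vertices of a graph arrive in a fixed order, and let a choice profile $\tau$ specify, for each vertex $w$, at most one primary choice $u_1(w)$ and at most one secondary choice $u_2(w)$, each a neighbor of $w$ that arrived before $w$. Let $G_\tau$ be the directed graph with primary arcs $(w,u_1(w))$ and secondary arcs $(w,u_2(w))$, and let $H_\tau$ be obtained from $G_\tau$ by removing every (primary or secondary) arc $(w,u)$ for which there exists a primary arc $(w',u)$ in $G_\tau$ with $w'$ arriving before $w$, and additionally removing a secondary arc $(w,u)$ whenever $(w,u)$ is also a primary arc. The matching computed in $H_\tau$ is obtained greedily: processing vertices in arrival order, when $w$ arrives it is matched to the head of its outgoing primary arc in $H_\tau$ if this arc exists and its head is currently unmatched, and otherwise to the head of its outgoing secondary arc in $H_\tau$ if this arc exists and its head is currently unmatched; otherwise $w$ stays unmatched. Let $\tau$ and $\tau'$ be two choice profiles that agree on the choices of all vertices except one vertex $v$. Then at every point in time (after each arrival), the number of vertices whose matched status (free or matched) differs between the matchings computed in $H_\tau$ and in $H_{\tau'}$ is at most two. -}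

module Defs where

open import Data.Nat using (ℕ; zero; suc; _<_; _<ᵇ_; _+_)
open import Data.Fin using (Fin; toℕ; _≟_)
open import Data.Bool using (Bool; true; false; if_then_else_; _∧_; _∨_; not; _xor_)
open import Data.Maybe using (Maybe; just; nothing)
open import Data.List using (List; allFin; take; foldl; map)
open import Data.Bool.ListAction using (any)
open import Data.Nat.ListAction using (sum)
import Data.Empty
open import Relation.Nullary.Decidable using (⌊_⌋)
open import Relation.Binary.PropositionalEquality using (_≡_)

-- Vertices are Fin n; arrival order is the order of indices (vertex i arrives at time i).

record Graph (n : ℕ) : Set₁ where
  field
    Adj     : Fin n → Fin n → Set
    Adj-sym : ∀ {x y} → Adj x y → Adj y x
    Adj-irr : ∀ {x} → Adj x x → Data.Empty.⊥
open Graph public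

record Profile (n : ℕ) : Set where
  field
    prim : Fin n → Maybe (Fin n)
    sec  : Fin n → Maybe (Fin n)
open Profile public

ValidChoice : ∀ {n} → Graph n → Fin n → Maybe (Fin n) → Set
ValidChoice G w nothing  = Data.Unit.⊤ where import Data.Unit
ValidChoice G w (just u) = (toℕ u < toℕ w) Data.Product.× Adj G w u where import Data.Product

ValidProfile : ∀ {n} → Graph n → Profile n → Set
ValidProfile G τ = ∀ w → ValidChoice G w (prim τ w) Data.Product.× ValidChoice G w (sec τ w)
  where import Data.Product

AgreeExcept : ∀ {n} → Fin n → Profile n → Profile n → Set
AgreeExcept v τ τ' = ∀ w → (w ≡ v → Data.Empty.⊥) →
  (prim τ w ≡ prim τ' w) Data.Product.× (sec τ w ≡ sec τ' w)
  where import Data.Empty ; import Data.Product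

headIs : ∀ {n} → Maybe (Fin n) → Fin n → Bool
headIs nothing  u = false
headIs (just x) u = ⌊ x ≟ u ⌋

blocked : ∀ {n} → Profile n → Fin n → Fin n → Bool
blocked {n} τ w u = any (λ w' → (toℕ w' <ᵇ toℕ w) ∧ headIs (prim τ w') u) (allFin n)

Hprim : ∀ {n} → Profile n → Fin n → Maybe (Fin n)
Hprim τ w with prim τ w
... | nothing = nothing
... | just u  = if blocked τ w u then nothing else just u

Hsec : ∀ {n} → Profile n → Fin n → Maybe (Fin n)
Hsec τ w with sec τ w
... | nothing = nothing
... | just u  = if blocked τ w u ∨ headIs (prim τ w) u then nothing else just u

-- matched status of each vertex: true = matched, false = free
Status : ℕ → Set
Status n = Fin n → Bool

matchPair : ∀ {n} → Status n → Fin n → Fin n → Status n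
matchPair st w u x = ⌊ x ≟ w ⌋ ∨ ⌊ x ≟ u ⌋ ∨ st x

trySec : ∀ {n} → Status n → Fin n → Maybe (Fin n) → Status n
trySec st w nothing  = st
trySec st w (just u) = if st u then st else matchPair st w u

tryPrim : ∀ {n} → Status n → Fin n → Maybe (Fin n) → Maybe (Fin n) → Status n
tryPrim st w nothing  s = trySec st w s
tryPrim st w (just u) s = if st u then trySec st w s else matchPair st w u

step : ∀ {n} → Profile n → Status n → Fin n → Status n
step τ st w = tryPrim st w (Hprim τ w) (Hsec τ w)

statusAt : ∀ {n} → Profile n → ℕ → Status n
statusAt {n} τ t = foldl (step τ) (λ _ → false) (take t (allFin n))

diffCount : ∀ {n} → Status n → Status n → ℕ
diffCount {n} st st' = sum (map (λ x → if st x xor st' x then 1 else 0) (allFin n))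

-- Before v arrives the two runs coincide, and v's own arrival makes them differ on at most
-- two vertices. A later vertex w has the same choices in τ and τ′, and its arcs in H_τ and
-- H_τ′ can differ only when an arc (w, u) is removed because of v's primary arc (v, u) alone.
-- Then no earlier vertex points to u, so (v, u) is an arc of H and u is matched as soon as v
-- has been processed: the removed arc could never have been used. Hence w sees the same
-- usable arcs in both runs, namely those of H for the profile with v's primary choice
-- deleted. A greedy step with the same arcs keeps the sets of matched vertices within two
-- vertices of each other: when the runs pick different partners, one of these partners is
-- already matched in the other run, so it is one of the vertices where the runs differed.
module Submission where

open import Defs
open import Data.Nat using (ℕ; _≤_)
open import Data.Fin using (Fin)

open import Data.Bool using (Bool; true; false; if_then_else_; _∧_; _∨_; _xor_; T)
open import Data.Bool.ListAction using (or)
open import Data.Bool.Properties using (T-∧; T-≡; ∨-zeroʳ; xor-same)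
open import Data.Fin as Fin using (toℕ; _≟_; fromℕ<)
open import Data.Fin.Properties using (toℕ-injective; toℕ-fromℕ<; toℕ<n) renaming (<⇒≢ to <⇒≢ᶠ)
open import Data.List using (List; []; _∷_; allFin; take; tabulate)
open import Data.List.Properties using (take-suc-tabulate; foldl-∷ʳ; map-tabulate; map-cong; tabulate-cong)
open import Data.List.Membership.Propositional using (_∉_; lose)
open import Data.List.Membership.Propositional.Properties using (∈-allFin)
open import Data.List.Relation.Unary.Any using (here; there; satisfied)
open import Data.List.Relation.Unary.Any.Properties using (any⁺; any⁻)
open import Data.Maybe using (Maybe; just; nothing; _<∣>_)
open import Data.Maybe.Properties using (just-injective)
open import Data.Nat using (zero; suc; _<_; _<ᵇ_; _+_; z≤n; s≤s)
open import Data.Nat.ListAction using (sum)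
open import Data.Nat.Properties
  using (<ᵇ⇒<; <⇒<ᵇ; <⇒≤; <-cmp; <-trans; ≤-<-trans; ≤-refl; ≤-reflexive; ≤-trans;
         +-mono-≤; m≤m+n; m<1+n⇒m<n∨m≡n; +-commutativeSemigroup; module ≤-Reasoning)
open import Algebra.Properties.CommutativeSemigroup +-commutativeSemigroup using (interchange)
open import Data.Product using (∃-syntax; _×_; _,_; proj₁; proj₂)
open import Data.Sum using (_⊎_; inj₁; inj₂)
import Data.Sum as Sum
open import Function using (_∘_; id)
open import Function.Bundles using (Equivalence)
open import Relation.Binary.Definitions using (tri<; tri≈; tri>)
open import Relation.Binary.PropositionalEquality
  using (_≡_; _≢_; ≢-sym; refl; sym; trans; cong; cong₂; cong-app; subst; subst₂; module ≡-Reasoning)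
open import Relation.Nullary using (yes; no; contradiction)
open import Relation.Nullary.Decidable using (⌊_⌋; toWitness; fromWitness)

sum-tabulate-mono-≤ : ∀ {m} {f g : Fin m → ℕ} → (∀ i → f i ≤ g i) →
                      sum (tabulate f) ≤ sum (tabulate g)
sum-tabulate-mono-≤ {zero}  f≤g = z≤n
sum-tabulate-mono-≤ {suc m} f≤g = +-mono-≤ (f≤g Fin.zero) (sum-tabulate-mono-≤ (f≤g ∘ Fin.suc))

sum-tabulate-+ : ∀ {m} (f g : Fin m → ℕ) →
                 sum (tabulate (λ i → f i + g i)) ≡ sum (tabulate f) + sum (tabulate g)
sum-tabulate-+ {zero}  f g = refl
sum-tabulate-+ {suc m} f g =
  trans (cong (f Fin.zero + g Fin.zero +_) (sum-tabulate-+ (f ∘ Fin.suc) (g ∘ Fin.suc)))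
        (interchange (f Fin.zero) (g Fin.zero) _ _)

sum-tabulate-0 : ∀ m → sum (tabulate {n = m} (λ _ → 0)) ≡ 0
sum-tabulate-0 zero    = refl
sum-tabulate-0 (suc m) = sum-tabulate-0 m

if-then-1-else-0≤1 : ∀ b → (if b then 1 else 0) ≤ 1
if-then-1-else-0≤1 true  = s≤s z≤n
if-then-1-else-0≤1 false = z≤n

indicator : ∀ {m} → Fin m → Fin m → ℕ
indicator p x = if ⌊ x ≟ p ⌋ then 1 else 0

-- Not provable by refl: ⌊_⌋ does not compute through the map′ in Fin's _≟_.
indicator-suc : ∀ {m} (p x : Fin m) → indicator (Fin.suc p) (Fin.suc x) ≡ indicator p x
indicator-suc p x with x ≟ p
... | yes _ = refl
... | no  _ = refl

sum-tabulate-indicator : ∀ {m} (p : Fin m) → sum (tabulate (indicator p)) ≡ 1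
sum-tabulate-indicator {suc m} Fin.zero    = cong suc (sum-tabulate-0 m)
sum-tabulate-indicator {suc m} (Fin.suc p) =
  trans (cong sum (tabulate-cong (indicator-suc p))) (sum-tabulate-indicator p)

module _ {n : ℕ} where

  private variable
    st st′ : Status n
    σ σ′ : Profile n
    a b p q u v w w′ x : Fin n
    c c′ : Fin n → Bool
    m m′ : Maybe (Fin n)
    D : List (Fin n)

  dropIf : (Fin n → Bool) → Maybe (Fin n) → Maybe (Fin n)
  dropIf c nothing  = nothing
  dropIf c (just u) = if c u then nothing else just u

  partner : Status n → Maybe (Fin n) → Maybe (Fin n) → Maybe (Fin n)
  partner st h s = dropIf st h <∣> dropIf st s

  mark : Status n → Fin n → Status n
  mark st x y = ⌊ y ≟ x ⌋ ∨ st y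

  matchWith : Status n → Fin n → Maybe (Fin n) → Status n
  matchWith st w nothing  = st
  matchWith st w (just u) = mark (mark st u) w

  trySec≡matchWith : ∀ st w s → trySec st w s ≡ matchWith st w (dropIf st s)
  trySec≡matchWith st w nothing  = refl
  trySec≡matchWith st w (just u) with st u
  ... | true  = refl
  ... | false = refl

  tryPrim≡matchWith-partner : ∀ st w h s → tryPrim st w h s ≡ matchWith st w (partner st h s)
  tryPrim≡matchWith-partner st w nothing  s = trySec≡matchWith st w s
  tryPrim≡matchWith-partner st w (just u) s with st u
  ... | true  = trySec≡matchWith st w s
  ... | false = refl

  mark-self : mark st x x ≡ true
  mark-self {x = x} with x ≟ x
  ... | yes _   = refl
  ... | no  x≢x = contradiction refl x≢x

  mark-≢ : w ≢ x → mark st x w ≡ st w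
  mark-≢ {w} {x} w≢x with w ≟ x
  ... | yes w≡x = contradiction w≡x w≢x
  ... | no  _   = refl

  mark-mono : st w ≡ true → mark st x w ≡ true
  mark-mono {w = w} {x} e rewrite e = ∨-zeroʳ ⌊ w ≟ x ⌋

  matchWith-mono : ∀ st x r → st w ≡ true → matchWith st x r w ≡ true
  matchWith-mono st x nothing  e = e
  matchWith-mono st x (just u) e = mark-mono {st = mark st u} (mark-mono {st = st} e)

  partner-free : ∀ h s → partner st h s ≡ just a → st a ≡ false
  partner-free {st} nothing (just u) e with st u in eu
  partner-free {st} nothing (just u) refl | false = eu
  partner-free {st} (just x) s e with st x in ex
  ... | true = partner-free nothing s e
  partner-free {st} (just x) s refl | false = ex

  partner-stable : ∀ h s → partner st h s ≡ just a → st′ a ≡ false →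
                   ∃[ b ] partner st′ h s ≡ just b × (b ≡ a ⊎ st b ≡ true)
  partner-stable {st} nothing (just u) e f with st u
  partner-stable {st} nothing (just u) refl f | false rewrite f = u , refl , inj₁ refl
  partner-stable {st} {st′ = st′} (just x) s e f with st x in ex
  ... | true with st′ x
  ...   | true  = partner-stable {st′ = st′} nothing s e f
  ...   | false = x , refl , inj₂ ex
  partner-stable {st} (just x) s refl f | false rewrite f = x , refl , inj₁ refl

  partner-lost : ∀ h s → partner st h s ≡ just a → partner st′ h s ≡ nothing → st′ a ≡ true
  partner-lost {a = a} {st′ = st′} h s e e′ with st′ a in f
  ... | true  = refl
  ... | false with partner-stable h s e f
  ...   | _ , e″ , _ = contradiction (trans (sym e′) e″) λ ()

  partner-split : ∀ h s → partner st h s ≡ just a → partner st′ h s ≡ just b → a ≢ b →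
                  st′ a ≡ true ⊎ st b ≡ true
  partner-split {st} {a = a} {st′} h s e e′ a≢b with st′ a in f
  ... | true  = inj₁ refl
  ... | false with partner-stable h s e f
  ...   | _ , e″ , inj₁ refl = contradiction (just-injective (trans (sym e″) e′)) a≢b
  ...   | _ , e″ , inj₂ m    =
    inj₂ (subst (λ y → st y ≡ true) (just-injective (trans (sym e″) e′)) m)

  ∉-pair : x ≢ p → x ≢ q → x ∉ p ∷ q ∷ []
  ∉-pair x≢p x≢q (here x≡p)         = x≢p x≡p
  ∉-pair x≢p x≢q (there (here x≡q)) = x≢q x≡q

  AgreeOutside : List (Fin n) → Status n → Status n → Set
  AgreeOutside D st st′ = ∀ x → x ∉ D → st x ≡ st′ x

  DifferOnAtMostTwo : Status n → Status n → Set
  DifferOnAtMostTwo st st′ = ∃[ p ] ∃[ q ] AgreeOutside (p ∷ q ∷ []) st st′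

  AgreeOutside-refl : AgreeOutside D st st
  AgreeOutside-refl _ _ = refl

  AgreeOutside-sym : AgreeOutside D st st′ → AgreeOutside D st′ st
  AgreeOutside-sym ag x x∉ = sym (ag x x∉)

  AgreeOutside-mark : AgreeOutside D st st′ → AgreeOutside D (mark st x) (mark st′ x)
  AgreeOutside-mark {x = x} ag y y∉ = cong (⌊ y ≟ x ⌋ ∨_) (ag y y∉)

  AgreeOutside-markˡ : AgreeOutside D st st′ → AgreeOutside (x ∷ D) (mark st x) st′
  AgreeOutside-markˡ {st = st} ag y y∉ = trans (mark-≢ {st = st} (y∉ ∘ here)) (ag y (y∉ ∘ there))

  AgreeOutside-markʳ : AgreeOutside D st st′ → AgreeOutside (x ∷ D) st (mark st′ x)
  AgreeOutside-markʳ = AgreeOutside-sym ∘ AgreeOutside-markˡ ∘ AgreeOutside-sym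

  AgreeOutside-resolve : st′ x ≡ true → AgreeOutside (x ∷ D) st st′ → AgreeOutside D (mark st x) st′
  AgreeOutside-resolve {x = x} e ag y y∉ with y ≟ x
  ... | yes refl = sym e
  ... | no  y≢x  = ag y λ { (here y≡x) → y≢x y≡x ; (there y∈D) → y∉ y∈D }

  AgreeOutside-settle : AgreeOutside (p ∷ q ∷ []) st st′ → st x ≡ false → st′ x ≡ true →
                        ∃[ o ] AgreeOutside (o ∷ []) (mark st x) st′
  AgreeOutside-settle {p} {q} {x = x} ag f t with x ≟ p | x ≟ q
  ... | yes refl | _        = q , AgreeOutside-resolve t ag
  ... | no _     | yes refl = p , AgreeOutside-resolve t λ y y∉ → ag y λ
    { (here y≡p) → y∉ (there (here y≡p)) ; (there (here y≡x)) → y∉ (here y≡x) }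
  ... | no x≢p   | no x≢q   = contradiction (trans (sym f) (trans (ag x (∉-pair x≢p x≢q)) t)) λ ()

  matchWith-partner-DifferOnAtMostTwo :
    ∀ w h s → AgreeOutside (p ∷ q ∷ []) st st′ →
    DifferOnAtMostTwo (matchWith st w (partner st h s)) (matchWith st′ w (partner st′ h s))
  matchWith-partner-DifferOnAtMostTwo {p} {q} {st} {st′} w h s ag
    with partner st h s in e | partner st′ h s in e′
  ... | nothing | nothing = p , q , ag
  ... | just a  | nothing =
        let o , ag′ = AgreeOutside-settle ag (partner-free h s e) (partner-lost h s e e′)
        in w , o , AgreeOutside-markˡ ag′
  ... | nothing | just b  =
        let o , ag′ = AgreeOutside-settle (AgreeOutside-sym ag) (partner-free h s e′) (partner-lost h s e′ e)
        in w , o , AgreeOutside-markʳ (AgreeOutside-sym ag′)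
  ... | just a  | just b with a ≟ b
  ...   | yes refl = p , q , AgreeOutside-mark (AgreeOutside-mark ag)
  ...   | no a≢b with partner-split h s e e′ a≢b
  ...     | inj₁ st′a = let o , ag′ = AgreeOutside-settle ag (partner-free h s e) st′a
                        in b , o , AgreeOutside-mark (AgreeOutside-markʳ ag′)
  ...     | inj₂ stb  = let o , ag′ = AgreeOutside-settle (AgreeOutside-sym ag) (partner-free h s e′) stb
                        in a , o , AgreeOutside-mark (AgreeOutside-markˡ (AgreeOutside-sym ag′))

  matchWith-DifferOnAtMostTwo : ∀ st w r r′ → DifferOnAtMostTwo (matchWith st w r) (matchWith st w r′)
  matchWith-DifferOnAtMostTwo st w nothing  nothing  = w , w , AgreeOutside-refl
  matchWith-DifferOnAtMostTwo st w (just a) nothing  =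
    w , a , AgreeOutside-markˡ (AgreeOutside-markˡ AgreeOutside-refl)
  matchWith-DifferOnAtMostTwo st w nothing  (just b) =
    w , b , AgreeOutside-markʳ (AgreeOutside-markʳ AgreeOutside-refl)
  matchWith-DifferOnAtMostTwo st w (just a) (just b) =
    b , a , AgreeOutside-mark (AgreeOutside-markʳ (AgreeOutside-markˡ AgreeOutside-refl))

  diffCount≤2 : AgreeOutside (p ∷ q ∷ []) st st′ → diffCount st st′ ≤ 2
  diffCount≤2 {p} {q} {st} {st′} ag = begin
    diffCount st st′                                        ≡⟨ cong sum (map-tabulate id differs) ⟩
    sum (tabulate differs)                                  ≤⟨ sum-tabulate-mono-≤ differs≤ ⟩
    sum (tabulate (λ x → indicator p x + indicator q x))   ≡⟨ sum-tabulate-+ (indicator p) (indicator q) ⟩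
    sum (tabulate (indicator p)) + sum (tabulate (indicator q))
      ≡⟨ cong₂ _+_ (sum-tabulate-indicator p) (sum-tabulate-indicator q) ⟩
    2                                                       ∎
    where
    open ≤-Reasoning
    differs : Fin n → ℕ
    differs x = if st x xor st′ x then 1 else 0
    differs≤ : ∀ x → (if st x xor st′ x then 1 else 0) ≤ indicator p x + indicator q x
    differs≤ x with x ≟ p | x ≟ q
    ... | yes _  | _      = ≤-trans (if-then-1-else-0≤1 _) (m≤m+n 1 _)
    ... | no _   | yes _  = if-then-1-else-0≤1 _
    ... | no x≢p | no x≢q rewrite ag x (∉-pair x≢p x≢q) | xor-same (st′ x) = z≤n

  dropIf-cong : m ≡ m′ → (∀ u → c u ≡ c′ u) → dropIf c m ≡ dropIf c′ m′
  dropIf-cong {nothing} refl _      = refl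
  dropIf-cong {just u}  refl c≗c′ rewrite c≗c′ u = refl

  dropIf-matched : ∀ c → st u ≡ true → dropIf st (dropIf c (just u)) ≡ nothing
  dropIf-matched {u = u} c e with c u
  ... | true  = refl
  ... | false rewrite e = refl

  dropIf-dropIf-cong : (∀ u → c u ≡ c′ u ⊎ st u ≡ true) →
                       dropIf st (dropIf c m) ≡ dropIf st (dropIf c′ m)
  dropIf-dropIf-cong {m = nothing} _ = refl
  dropIf-dropIf-cong {c} {c′} {m = just u} c≈c′ with c≈c′ u
  ... | inj₁ e       rewrite e = refl
  ... | inj₂ matched = trans (dropIf-matched c matched) (sym (dropIf-matched c′ matched))

  Hprim≡dropIf : ∀ σ w → Hprim σ w ≡ dropIf (blocked σ w) (prim σ w)
  Hprim≡dropIf σ w with prim σ w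
  ... | nothing = refl
  ... | just _  = refl

  Hsec≡dropIf : ∀ σ w → Hsec σ w ≡ dropIf (λ u → blocked σ w u ∨ headIs (prim σ w) u) (sec σ w)
  Hsec≡dropIf σ w with sec σ w
  ... | nothing = refl
  ... | just _  = refl

  Hprim-just : prim σ w ≡ just u → blocked σ w u ≡ false → Hprim σ w ≡ just u
  Hprim-just {σ} {w} e b rewrite Hprim≡dropIf σ w | e | b = refl

  headIs⁺ : m ≡ just u → T (headIs m u)
  headIs⁺ refl = fromWitness refl

  headIs⁻ : ∀ m → T (headIs m u) → m ≡ just u
  headIs⁻ (just x) h = cong just (toWitness h)

  blocked⁺ : ∀ σ w → toℕ w′ < toℕ w → prim σ w′ ≡ just u → blocked σ w u ≡ true
  blocked⁺ {w′} σ w w′<w e =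
    Equivalence.to T-≡ (any⁺ _ (lose (∈-allFin w′) (Equivalence.from T-∧ (<⇒<ᵇ w′<w , headIs⁺ e))))

  blocked⁻ : ∀ σ w → blocked σ w u ≡ true → ∃[ w′ ] toℕ w′ < toℕ w × prim σ w′ ≡ just u
  blocked⁻ σ w b =
    let w′ , hit       = satisfied (any⁻ _ (allFin n) (Equivalence.from T-≡ b))
        earlier , head = Equivalence.to T-∧ hit
    in w′ , <ᵇ⇒< _ _ earlier , headIs⁻ (prim σ w′) head

  blocked-local : (∀ w′ → toℕ w′ < toℕ w → prim σ w′ ≡ prim σ′ w′) →
                  ∀ u → blocked σ w u ≡ blocked σ′ w u
  blocked-local {w} {σ} {σ′} same u = cong or (map-cong same-test (allFin n))
    where
    same-test : ∀ w′ → ((toℕ w′ <ᵇ toℕ w) ∧ headIs (prim σ w′) u) ≡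
                       ((toℕ w′ <ᵇ toℕ w) ∧ headIs (prim σ′ w′) u)
    same-test w′ with toℕ w′ <ᵇ toℕ w in earlier
    ... | false = refl
    ... | true rewrite same w′ (<ᵇ⇒< _ _ (Equivalence.from T-≡ earlier)) = refl

  arcs-local : (∀ w′ → toℕ w′ ≤ toℕ w → prim σ w′ ≡ prim σ′ w′) → sec σ w ≡ sec σ′ w →
               Hprim σ w ≡ Hprim σ′ w × Hsec σ w ≡ Hsec σ′ w
  arcs-local {w} {σ} {σ′} same-prim same-sec =
    trans (Hprim≡dropIf σ w) (trans (dropIf-cong prim-w same-blocked) (sym (Hprim≡dropIf σ′ w))) ,
    trans (Hsec≡dropIf σ w) (trans (dropIf-cong same-sec same-sec-test) (sym (Hsec≡dropIf σ′ w)))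
    where
    prim-w : prim σ w ≡ prim σ′ w
    prim-w = same-prim w ≤-refl
    same-blocked : ∀ u → blocked σ w u ≡ blocked σ′ w u
    same-blocked = blocked-local {w = w} {σ = σ} {σ′ = σ′} λ w′ w′<w → same-prim w′ (<⇒≤ w′<w)
    same-sec-test : ∀ u → (blocked σ w u ∨ headIs (prim σ w) u) ≡
                          (blocked σ′ w u ∨ headIs (prim σ′ w) u)
    same-sec-test u = cong₂ _∨_ (same-blocked u) (cong (λ m → headIs m u) prim-w)

  withoutPrim : Fin n → Profile n → Profile n
  withoutPrim v σ = record σ { prim = λ w → if ⌊ w ≟ v ⌋ then nothing else prim σ w }

  prim-withoutPrim-≢ : w ≢ v → prim (withoutPrim v σ) w ≡ prim σ w
  prim-withoutPrim-≢ {w} {v} w≢v with w ≟ v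
  ... | yes w≡v = contradiction w≡v w≢v
  ... | no  _   = refl

  prim-withoutPrim-just : prim (withoutPrim v σ) w ≡ just u → w ≢ v × prim σ w ≡ just u
  prim-withoutPrim-just {v} {w = w} e with w ≟ v
  ... | no w≢v = w≢v , e

  blocked-withoutPrim⇒blocked : blocked (withoutPrim v σ) w u ≡ true → blocked σ w u ≡ true
  blocked-withoutPrim⇒blocked {v} {σ} {w} b =
    let w′ , w′<w , e = blocked⁻ (withoutPrim v σ) w b
    in blocked⁺ σ w w′<w (proj₂ (prim-withoutPrim-just {v} {σ} e))

  blocked⇒blocked-withoutPrim : blocked σ w u ≡ true →
                                blocked (withoutPrim v σ) w u ≡ true ⊎ prim σ v ≡ just u
  blocked⇒blocked-withoutPrim {σ} {w} {v = v} b with blocked⁻ σ w b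
  ... | w′ , w′<w , e with w′ ≟ v
  ...   | yes refl = inj₂ e
  ...   | no w′≢v  =
    inj₁ (blocked⁺ (withoutPrim v σ) w w′<w (trans (prim-withoutPrim-≢ {σ = σ} w′≢v) e))

  blocked⇒blocked-withoutPrim-later : toℕ v < toℕ w → blocked σ v u ≡ true →
                                      blocked (withoutPrim v σ) w u ≡ true
  blocked⇒blocked-withoutPrim-later {v} {w} {σ} v<w b =
    let w′ , w′<v , e = blocked⁻ σ v b
    in blocked⁺ (withoutPrim v σ) w (<-trans w′<v v<w)
                (trans (prim-withoutPrim-≢ {σ = σ} (<⇒≢ᶠ w′<v)) e)

  -- The only arcs that v's primary arc removes lead to the head of v's arc in H_σ.
  blocked-withoutPrim-or-matched :
    toℕ v < toℕ w → (∀ {u} → Hprim σ v ≡ just u → st u ≡ true) →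
    ∀ u → blocked σ w u ≡ blocked (withoutPrim v σ) w u ⊎ st u ≡ true
  blocked-withoutPrim-or-matched {v} {w} {σ} v<w v-head-matched u with blocked (withoutPrim v σ) w u in b₋
  ... | true  = inj₁ (blocked-withoutPrim⇒blocked {v} {σ} {w} b₋)
  ... | false with blocked σ w u in b
  ...   | false = inj₁ refl
  ...   | true with blocked⇒blocked-withoutPrim {σ} {w} {v = v} b | blocked σ v u in bv
  ...     | inj₁ b₋′ | _     = contradiction (trans (sym b₋) b₋′) λ ()
  ...     | inj₂ _   | true  =
    contradiction (trans (sym b₋) (blocked⇒blocked-withoutPrim-later {σ = σ} v<w bv)) λ ()
  ...     | inj₂ e   | false = inj₂ (v-head-matched (Hprim-just {σ = σ} {w = v} e bv))

  Hprim-withoutPrim : w ≢ v → Hprim (withoutPrim v σ) w ≡ dropIf (blocked (withoutPrim v σ) w) (prim σ w)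
  Hprim-withoutPrim {w} {v} {σ} w≢v =
    trans (Hprim≡dropIf (withoutPrim v σ) w) (dropIf-cong (prim-withoutPrim-≢ {σ = σ} w≢v) λ _ → refl)

  Hsec-withoutPrim : w ≢ v → Hsec (withoutPrim v σ) w ≡
                     dropIf (λ u → blocked (withoutPrim v σ) w u ∨ headIs (prim σ w) u) (sec σ w)
  Hsec-withoutPrim {w} {v} {σ} w≢v =
    trans (Hsec≡dropIf (withoutPrim v σ) w)
          (dropIf-cong {m = sec σ w} refl λ u →
             cong (λ m → blocked (withoutPrim v σ) w u ∨ headIs m u) (prim-withoutPrim-≢ {σ = σ} w≢v))

  partner-withoutPrim :
    toℕ v < toℕ w → (∀ {u} → Hprim σ v ≡ just u → st u ≡ true) →
    partner st (Hprim σ w) (Hsec σ w) ≡ partner st (Hprim (withoutPrim v σ) w) (Hsec (withoutPrim v σ) w)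
  partner-withoutPrim {v} {w} {σ} {st} v<w v-head-matched =
    trans (cong₂ (partner st) (Hprim≡dropIf σ w) (Hsec≡dropIf σ w))
   (trans (cong₂ _<∣>_ (dropIf-dropIf-cong {m = prim σ w} same) (dropIf-dropIf-cong {m = sec σ w} same-sec))
          (sym (cong₂ (partner st) (Hprim-withoutPrim {σ = σ} w≢v) (Hsec-withoutPrim {σ = σ} w≢v))))
    where
    w≢v : w ≢ v
    w≢v = ≢-sym (<⇒≢ᶠ v<w)
    same : ∀ u → blocked σ w u ≡ blocked (withoutPrim v σ) w u ⊎ st u ≡ true
    same = blocked-withoutPrim-or-matched v<w v-head-matched
    same-sec : ∀ u → (blocked σ w u ∨ headIs (prim σ w) u) ≡
                     (blocked (withoutPrim v σ) w u ∨ headIs (prim σ w) u) ⊎ st u ≡ true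
    same-sec = λ u → Sum.map₁ (cong (_∨ headIs (prim σ w) u)) (same u)

  step≡matchWith-partner : ∀ σ st w → step σ st w ≡ matchWith st w (partner st (Hprim σ w) (Hsec σ w))
  step≡matchWith-partner σ st w = tryPrim≡matchWith-partner st w (Hprim σ w) (Hsec σ w)

  step-mono : ∀ σ → st x ≡ true → step σ st w x ≡ true
  step-mono {st} {x} {w} σ e =
    trans (cong-app (step≡matchWith-partner σ st w) x)
          (matchWith-mono st w (partner st (Hprim σ w) (Hsec σ w)) e)

  step-matches-Hprim-head : ∀ σ st → Hprim σ w ≡ just u → step σ st w u ≡ true
  step-matches-Hprim-head {w} {u} σ st e =
    trans (cong-app (step≡matchWith-partner σ st w) u)
          (subst (λ h → matchWith st w (partner st h (Hsec σ w)) u ≡ true) (sym e) primary-matched)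
    where
    primary-matched : matchWith st w (partner st (just u) (Hsec σ w)) u ≡ true
    primary-matched with st u in matched
    ... | true  = matchWith-mono st w (dropIf st (Hsec σ w)) matched
    ... | false = mark-mono {st = mark st u} {x = w} (mark-self {st = st} {x = u})

  step-DifferOnAtMostTwo : ∀ σ σ′ st w → DifferOnAtMostTwo (step σ st w) (step σ′ st w)
  step-DifferOnAtMostTwo σ σ′ st w =
    subst₂ DifferOnAtMostTwo (sym (step≡matchWith-partner σ st w)) (sym (step≡matchWith-partner σ′ st w))
           (matchWith-DifferOnAtMostTwo st w (partner st (Hprim σ w) (Hsec σ w))
                                             (partner st (Hprim σ′ w) (Hsec σ′ w)))

  statusAt-suc : ∀ σ (i : Fin n) → statusAt σ (suc (toℕ i)) ≡ step σ (statusAt σ (toℕ i)) i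
  statusAt-suc σ i rewrite take-suc-tabulate {n = n} id i =
    foldl-∷ʳ (step σ) (λ _ → false) i (take (toℕ i) (allFin n))

  arrival-induction : (P : ℕ → Set) → P 0 → (∀ (i : Fin n) → P (toℕ i) → P (suc (toℕ i))) →
                      ∀ t → t ≤ n → P t
  arrival-induction P base step zero    _     = base
  arrival-induction P base step (suc t) t<n =
    subst (P ∘ suc) (toℕ-fromℕ< t<n)
          (step (fromℕ< t<n)
                (subst P (sym (toℕ-fromℕ< t<n)) (arrival-induction P base step t (<⇒≤ t<n))))

  Hprim-head-matched : ∀ σ w (i : Fin n) → toℕ w < toℕ i → ∀ {u} → Hprim σ w ≡ just u →
                       statusAt σ (toℕ i) u ≡ true
  Hprim-head-matched σ w i w<i {u} e = arrival-induction P (λ ()) arrival (toℕ i) (<⇒≤ (toℕ<n i)) w<i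
    where
    P : ℕ → Set
    P t = toℕ w < t → statusAt σ t u ≡ true
    arrival : ∀ i → P (toℕ i) → P (suc (toℕ i))
    arrival i IH w<1+i rewrite statusAt-suc σ i with m<1+n⇒m<n∨m≡n w<1+i
    ... | inj₁ w<i = step-mono σ (IH w<i)
    ... | inj₂ w≡i with toℕ-injective w≡i
    ...   | refl = step-matches-Hprim-head σ _ e

  statusAt-suc-after-v :
    ∀ σ v (i : Fin n) → toℕ v < toℕ i → let st = statusAt σ (toℕ i) in
    statusAt σ (suc (toℕ i)) ≡
    matchWith st i (partner st (Hprim (withoutPrim v σ) i) (Hsec (withoutPrim v σ) i))
  statusAt-suc-after-v σ v i v<i =
    trans (statusAt-suc σ i)
   (trans (step≡matchWith-partner σ _ i)
          (cong (matchWith _ i) (partner-withoutPrim v<i (Hprim-head-matched σ v i v<i))))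

  module _ {v : Fin n} {τ τ′ : Profile n} (τ≈τ′ : AgreeExcept v τ τ′) where

    arcs-before-v : toℕ w < toℕ v → Hprim τ w ≡ Hprim τ′ w × Hsec τ w ≡ Hsec τ′ w
    arcs-before-v {w} w<v =
      arcs-local {w = w} {σ = τ} {σ′ = τ′}
                 (λ w′ w′≤w → proj₁ (τ≈τ′ w′ (<⇒≢ᶠ (≤-<-trans w′≤w w<v))))
                 (proj₂ (τ≈τ′ w (<⇒≢ᶠ w<v)))

    arcs-withoutPrim : w ≢ v → Hprim (withoutPrim v τ) w ≡ Hprim (withoutPrim v τ′) w ×
                               Hsec (withoutPrim v τ) w ≡ Hsec (withoutPrim v τ′) w
    arcs-withoutPrim {w} w≢v =
      arcs-local {w = w} {σ = withoutPrim v τ} {σ′ = withoutPrim v τ′}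
                 (λ w′ _ → same-prim w′) (proj₂ (τ≈τ′ w w≢v))
      where
      same-prim : ∀ w′ → prim (withoutPrim v τ) w′ ≡ prim (withoutPrim v τ′) w′
      same-prim w′ with w′ ≟ v
      ... | yes _   = refl
      ... | no w′≢v = proj₁ (τ≈τ′ w′ w′≢v)

    statusAt-before-v : ∀ t → t ≤ toℕ v → statusAt τ t ≡ statusAt τ′ t
    statusAt-before-v t t≤v =
      arrival-induction P (λ _ → refl) arrival t (≤-trans t≤v (<⇒≤ (toℕ<n v))) t≤v
      where
      P : ℕ → Set
      P t = t ≤ toℕ v → statusAt τ t ≡ statusAt τ′ t
      arrival : ∀ i → P (toℕ i) → P (suc (toℕ i))
      arrival i IH i<v = begin
        statusAt τ (suc (toℕ i))          ≡⟨ statusAt-suc τ i ⟩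
        step τ (statusAt τ (toℕ i)) i     ≡⟨ cong (λ st → step τ st i) (IH (<⇒≤ i<v)) ⟩
        step τ (statusAt τ′ (toℕ i)) i    ≡⟨ cong₂ (tryPrim _ i) (proj₁ same-arcs) (proj₂ same-arcs) ⟩
        step τ′ (statusAt τ′ (toℕ i)) i   ≡⟨ statusAt-suc τ′ i ⟨
        statusAt τ′ (suc (toℕ i))         ∎
        where
        open ≡-Reasoning
        same-arcs = arcs-before-v i<v

    arrival-after-v : ∀ i → toℕ v < toℕ i →
                      DifferOnAtMostTwo (statusAt τ (toℕ i)) (statusAt τ′ (toℕ i)) →
                      DifferOnAtMostTwo (statusAt τ (suc (toℕ i))) (statusAt τ′ (suc (toℕ i)))
    arrival-after-v i v<i (_ , _ , agree) =
      subst₂ DifferOnAtMostTwo (sym (statusAt-suc-after-v τ v i v<i)) (sym statusAt-τ′)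
             (matchWith-partner-DifferOnAtMostTwo i (Hprim (withoutPrim v τ) i) (Hsec (withoutPrim v τ) i) agree)
      where
      current′ : Status n
      current′ = statusAt τ′ (toℕ i)
      same-arcs : Hprim (withoutPrim v τ) i ≡ Hprim (withoutPrim v τ′) i ×
                  Hsec (withoutPrim v τ) i ≡ Hsec (withoutPrim v τ′) i
      same-arcs = arcs-withoutPrim (≢-sym (<⇒≢ᶠ v<i))
      statusAt-τ′ : statusAt τ′ (suc (toℕ i)) ≡
                    matchWith current′ i
                              (partner current′ (Hprim (withoutPrim v τ) i) (Hsec (withoutPrim v τ) i))
      statusAt-τ′ = trans (statusAt-suc-after-v τ′ v i v<i)
                          (cong₂ (λ h s → matchWith current′ i (partner current′ h s))
                                 (sym (proj₁ same-arcs)) (sym (proj₂ same-arcs)))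

    statusAt-DifferOnAtMostTwo : ∀ t → t ≤ n → DifferOnAtMostTwo (statusAt τ t) (statusAt τ′ t)
    statusAt-DifferOnAtMostTwo = arrival-induction _ (v , v , AgreeOutside-refl) arrival
      where
      arrival : ∀ i → DifferOnAtMostTwo (statusAt τ (toℕ i)) (statusAt τ′ (toℕ i)) →
                DifferOnAtMostTwo (statusAt τ (suc (toℕ i))) (statusAt τ′ (suc (toℕ i)))
      arrival i IH with <-cmp (toℕ i) (toℕ v)
      ... | tri< i<v _ _ = subst (DifferOnAtMostTwo _) (statusAt-before-v _ i<v) (v , v , AgreeOutside-refl)
      ... | tri≈ _ i≡v _
        rewrite statusAt-suc τ i | statusAt-suc τ′ i | statusAt-before-v _ (≤-reflexive i≡v)
        = step-DifferOnAtMostTwo τ τ′ _ i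
      ... | tri> _ _ v<i = arrival-after-v i v<i IH

lemma4 : ∀ {n} (G : Graph n) (τ τ' : Profile n) (v : Fin n) →
         ValidProfile G τ → ValidProfile G τ' → AgreeExcept v τ τ' →
         ∀ (t : ℕ) → t ≤ n → diffCount (statusAt τ t) (statusAt τ' t) ≤ 2
lemma4 G τ τ′ v _ _ τ≈τ′ t t≤n =
  let _ , _ , agree = statusAt-DifferOnAtMostTwo τ≈τ′ t t≤n in diffCount≤2 agree
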